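{- Let $G$ be a $3$-regular equatorial graph with girth $5$ and equator $q$. Then $q\equiv 0\pmod 5$, and $G$ is isomorphic to $\mathcal{F}(3,5,q)$.
   Context: A cycle $C$ in $G$ is isometric if $d_C(x,y)=d_G(x,y)$ for all $x,y\in V(C)$; the equator is the length of a longest isometric cycle. An equatorial graph with girth $5$ and minimum degree $3$ is a finite graph with girth $5$, minimum degree $3$ and equator $q>15$ whose order is exactly $\frac{q}{5}\cdot 10=2q$ (in general: order $\frac{q}{g}M(\delta,g)$ with $q>6k+3$, $k=\lceil g/2\rceil-1$, where $M(3,5)=10$ is the Moore bound). For $q=5j$ with $j\ge 3$, $\mathcal{F}(3,5,q)$ is the graph obtained as follows: let $P$ be the Petersen graph and $uv$ an edge of $P$; take $j$ disjoint copies $F_1,\dots,F_j$ of $P-uv$, with $u_i,v_i$ the copies of $u,v$ in $F_i$, and add the edges $v_1u_2,v_2u_3,\dots,v_{j-1}u_j,v_ju_1$. -}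

module Defs where

open import Data.Bool using (Bool; true; false; _∧_; _∨_; if_then_else_)
open import Data.Nat using (ℕ; zero; suc; _≤_; _<_; _∸_; _⊓_; ∣_-_∣; _≡ᵇ_; _*_)
open import Data.Fin using (Fin; toℕ)
open import Data.List using (List; []; _∷_; map)
open import Data.Nat.ListAction using (sum)
open import Data.Bool.ListAction using (any)
open import Data.List using () renaming (allFin to allFinL)
open import Data.Product using (Σ; _×_; _,_; proj₁; proj₂)
open import Data.Sum using (_⊎_)
open import Function.Bundles using (_↔_; Inverse)
open import Relation.Binary.PropositionalEquality using (_≡_)

record Graph (n : ℕ) : Set where
  field
    adj    : Fin n → Fin n → Bool
    sym    : ∀ x y → adj x y ≡ adj y x
    irrefl : ∀ x → adj x x ≡ false
open Graph public

module _ {n : ℕ} (G : Graph n) where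

  degree : Fin n → ℕ
  degree v = sum (map (λ w → if adj G v w then 1 else 0) (allFinL n))

  Regular : ℕ → Set
  Regular d = ∀ v → degree v ≡ d

  data Walk : Fin n → Fin n → ℕ → Set where
    here : ∀ {x} → Walk x x 0
    step : ∀ {x y z k} → adj G x y ≡ true → Walk y z k → Walk x z (suc k)

  IsDist : Fin n → Fin n → ℕ → Set
  IsDist x y d = Walk x y d × (∀ m → Walk x y m → d ≤ m)

  IsCycle : (k : ℕ) → (Fin k → Fin n) → Set
  IsCycle k c =
    (3 ≤ k)
    × (∀ i j → c i ≡ c j → i ≡ j)
    × (∀ i j → (suc (toℕ i) ≡ toℕ j ⊎ (suc (toℕ i) ≡ k × toℕ j ≡ 0))
             → adj G (c i) (c j) ≡ true)

  cycleDist : (k : ℕ) → Fin k → Fin k → ℕ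
  cycleDist k i j = ∣ toℕ i - toℕ j ∣ ⊓ (k ∸ ∣ toℕ i - toℕ j ∣)

  IsIsometricCycle : (k : ℕ) → (Fin k → Fin n) → Set
  IsIsometricCycle k c =
    IsCycle k c × (∀ i j → IsDist (c i) (c j) (cycleDist k i j))

  Girth : ℕ → Set
  Girth g = Σ (Fin g → Fin n) (IsCycle g)
          × (∀ k (c : Fin k → Fin n) → IsCycle k c → g ≤ k)

  Equator : ℕ → Set
  Equator q = Σ (Fin q → Fin n) (IsIsometricCycle q)
            × (∀ k (c : Fin k → Fin n) → IsIsometricCycle k c → k ≤ q)

-- Petersen graph on {0..9}: outer 5-cycle 0-1-2-3-4, spokes i–(i+5),
-- inner pentagram 5-7-9-6-8-5.  Distinguished edge uv with u = 0, v = 1.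

petersenEdges : List (ℕ × ℕ)
petersenEdges =
  (0 , 1) ∷ (1 , 2) ∷ (2 , 3) ∷ (3 , 4) ∷ (4 , 0) ∷
  (0 , 5) ∷ (1 , 6) ∷ (2 , 7) ∷ (3 , 8) ∷ (4 , 9) ∷
  (5 , 7) ∷ (7 , 9) ∷ (9 , 6) ∷ (6 , 8) ∷ (8 , 5) ∷ []

petAdjℕ : ℕ → ℕ → Bool
petAdjℕ a b = any (λ e → ((proj₁ e ≡ᵇ a) ∧ (proj₂ e ≡ᵇ b))
                       ∨ ((proj₁ e ≡ᵇ b) ∧ (proj₂ e ≡ᵇ a))) petersenEdges

petU petV : ℕ
petU = 0
petV = 1

petMinusUVℕ : ℕ → ℕ → Bool
petMinusUVℕ a b =
  petAdjℕ a b ∧ Data.Bool.not (((a ≡ᵇ petU) ∧ (b ≡ᵇ petV)) ∨ ((a ≡ᵇ petV) ∧ (b ≡ᵇ petU)))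
  where import Data.Bool

succMod : (j : ℕ) → Fin j → Fin j → Bool
succMod j i i' = (suc (toℕ i) ≡ᵇ toℕ i') ∨ ((suc (toℕ i) ≡ᵇ j) ∧ (toℕ i' ≡ᵇ 0))

-- F(3,5,5j): vertex (i , a) is the copy of Petersen vertex a in F_i;
-- edges inside each copy of P - uv, plus v_i u_{i+1} (indices mod j).
FAdj : (j : ℕ) → Fin j × Fin 10 → Fin j × Fin 10 → Bool
FAdj j (i , a) (i' , b) =
     ((toℕ i ≡ᵇ toℕ i') ∧ petMinusUVℕ (toℕ a) (toℕ b))
  ∨ ((toℕ a ≡ᵇ petV) ∧ (toℕ b ≡ᵇ petU) ∧ succMod j i i')
  ∨ ((toℕ a ≡ᵇ petU) ∧ (toℕ b ≡ᵇ petV) ∧ succMod j i' i)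

Isomorphic : ∀ {n} {V : Set} → Graph n → (V → V → Bool) → Set
Isomorphic {n} {V} G H =
  Σ (Fin n ↔ V) λ e → ∀ x y → adj G x y ≡ H (Inverse.to e x) (Inverse.to e y)

{-# OPTIONS --safe #-}
module Submission where

-- Let c be an isometric q-cycle with vertices C i (indices mod q). Each C i has a third neighbour X i;
-- isometry and girth 5 show that the X i are distinct and off the cycle, and that X i can be adjacent only to
-- C i, X (i ± 2) and X (i ± 3). As n = 2q, the C i and X i are all of G. By 3-regularity at least two of the
-- four possible chords at X i are present, and four chord combinations are excluded because they would give
-- walks between cycle vertices shorter than their distance along c. Writing a i and b i for the chords
-- X i X (i+2) and X i X (i+3), this yields a (i+3) = not (b i) and b (i+5) ⇒ b i; with q-periodicity the
-- latter makes b 5-periodic, so (a , b) is a shift of the chord pattern of F(3,5,q) and 5 divides q.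
-- Mapping the q/5 copies of P − uv onto consecutive runs of five cycle positions then preserves edges, and
-- since both graphs are 3-regular it reflects them as well.

open import Defs hiding (sym)
open import Data.Bool using (Bool; true; false; if_then_else_; not; _∧_; _∨_; T; T?)
open import Data.Bool.Properties using (¬-not; T-≡; T-∨; T-∧; ∨-zeroʳ) renaming (_≟_ to _≟ᵇ_)
open import Data.Empty using (⊥; ⊥-elim)
open import Data.Fin using (Fin; zero; suc; _≟_; toℕ; fromℕ; inject₁; lower₁; punchOut; splitAt; join; combine)
open import Data.Fin.Patterns
open import Data.Fin.Properties
  using (any?; all?; injective⇒≤; punchOut-injective; toℕ-injective; toℕ-inject₁; toℕ-fromℕ; toℕ-fromℕ<;
         toℕ-lower₁; toℕ<n; join-splitAt; toℕ-combine; combine-injectiveˡ; combine-injectiveʳ; *↔×)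
open import Data.List using (List; []; _∷_; length; tabulate; map; lookup; _++_; filter; allFin)
open import Data.List.Membership.Propositional using (_∈_; _∉_)
open import Data.List.Membership.Propositional.Properties using (∈-lookup; ∈-map⁻)
open import Data.List.Properties using (map-tabulate; map-++; map-∘; map-id; length-map)
open import Data.List.Relation.Unary.All as All using (All; []; _∷_)
open import Data.List.Relation.Unary.All.Properties using (¬Any⇒All¬; all-filter; ++⁺)
  renaming (map⁺ to All-map⁺)
open import Data.List.Relation.Unary.Any using (here; there)
open import Data.List.Relation.Unary.Unique.Propositional using (Unique; []; _∷_)
open import Data.List.Relation.Unary.Unique.DecPropositional (_≟_ {10}) using (unique?)
import Data.List.Relation.Unary.Unique.Propositional.Properties as Unique
open import Data.Nat
  using (ℕ; zero; suc; pred; _+_; _*_; _∸_; _⊓_; _≤_; _<_; _≤?_; _<?_; _≡ᵇ_; z≤n; s≤s; NonZero)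
open import Data.Nat.Divisibility using (_∣_; divides; m%n≡0⇒n∣m)
open import Data.Nat.DivMod
  using (_%_; _/_; _mod_; m≡m%n+[m/n]*n; m%n<n; n%n≡0; m%n%n≡m%n; [m+n]%n≡m%n; %-distribˡ-+; m<n⇒m%n≡m)
open import Data.Nat.ListAction using () renaming (sum to listSum)
open import Data.Nat.Properties
  using (+-comm; +-assoc; +-suc; +-identityʳ; *-comm; *-assoc; *-suc; *-zeroʳ; *-identityʳ; *-cancelʳ-<;
         suc-injective; suc-pred; ≤-trans; ≤-total; <⇒≤; <⇒≱; ≤⇒≯; ≰⇒>; 1+n≰n; ≤-<-trans; <-≤-trans; <-trans;
         m<m+n; m≤n+m; +-mono-≤; +-monoˡ-<; m≤n⇒m<n∨m≡n; m+n≡0⇒n≡0; ⊓-sel; m∸n+n≡m; m∸n≤m;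
         m≤n⇒∣m-n∣≡n∸m; m≤n⇒∣n-m∣≡n∸m; ≡ᵇ⇒≡; +-0-commutativeMonoid; module ≤-Reasoning)
  renaming (_≟_ to _≟ℕ_)
open import Algebra.Properties.CommutativeMonoid.Sum +-0-commutativeMonoid
  using (sum; ∑-distrib-+; sum-replicate-zero)
open import Data.Product using (Σ; ∃; _×_; _,_; proj₁; proj₂)
open import Data.Product.Properties using (≡-dec)
open import Data.Sum as Sum using (_⊎_; inj₁; inj₂)
open import Data.Vec as Vec using ([]; _∷_)
open import Function using (id; _∘_; Equivalence; Inverse; _↔_; mk↔ₛ′)
open import Relation.Nullary using (¬_; Dec; yes; no; does; contradiction)
open import Relation.Nullary.Decidable using (_×-dec_; _→-dec_; ¬?; from-yes; from-no; True; toWitness)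
open import Relation.Binary.PropositionalEquality

open Equivalence

-- Counting

trues : ∀ {k} → (Fin k → Bool) → ℕ
trues v = sum (λ t → if v t then 1 else 0)

occurrences : ∀ {k} → List (Fin k) → Fin k → ℕ
occurrences []       t = 0
occurrences (s ∷ ss) t = (if does (s ≟ t) then 1 else 0) + occurrences ss t

sum-mono-≤ : ∀ {k} {f g : Fin k → ℕ} → (∀ t → f t ≤ g t) → sum f ≤ sum g
sum-mono-≤ {zero}  _   = z≤n
sum-mono-≤ {suc k} f≤g = +-mono-≤ (f≤g zero) (sum-mono-≤ (f≤g ∘ suc))

sum-indicator : ∀ {k} (s : Fin k) → sum (λ t → if does (s ≟ t) then 1 else 0) ≡ 1
sum-indicator {suc k} zero    = cong suc (sum-replicate-zero k)
sum-indicator         (suc s) = sum-indicator s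

sum-occurrences : ∀ {k} (ss : List (Fin k)) → sum (occurrences ss) ≡ length ss
sum-occurrences {k} []       = sum-replicate-zero k
sum-occurrences     (s ∷ ss) =
  trans (∑-distrib-+ _ (occurrences ss)) (cong₂ _+_ (sum-indicator s) (sum-occurrences ss))

∈⇒occurrences>0 : ∀ {k} {t : Fin k} {ss} → t ∈ ss → 1 ≤ occurrences ss t
∈⇒occurrences>0 {t = t} (here refl) with t ≟ t
... | yes _  = s≤s z≤n
... | no t≢t = contradiction refl t≢t
∈⇒occurrences>0 {ss = s ∷ _} (there t∈) = ≤-trans (∈⇒occurrences>0 t∈) (m≤n+m _ _)

∉⇒occurrences≡0 : ∀ {k} {t : Fin k} {ss} → All (t ≢_) ss → occurrences ss t ≡ 0
∉⇒occurrences≡0                 []         = refl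
∉⇒occurrences≡0 {t = t} {s ∷ _} (t≢s ∷ t∉) with s ≟ t
... | yes s≡t = contradiction (sym s≡t) t≢s
... | no  _   = ∉⇒occurrences≡0 t∉

trues-≤-length : ∀ {k} (v : Fin k → Bool) (ss : List (Fin k)) →
                 (∀ t → v t ≡ true → t ∈ ss) → trues v ≤ length ss
trues-≤-length v ss covers = begin
  trues v              ≤⟨ sum-mono-≤ indicator≤occurrences ⟩
  sum (occurrences ss) ≡⟨ sum-occurrences ss ⟩
  length ss            ∎
  where
  open ≤-Reasoning
  indicator≤occurrences : ∀ t → (if v t then 1 else 0) ≤ occurrences ss t
  indicator≤occurrences t with v t in vt
  ... | false = z≤n
  ... | true  = ∈⇒occurrences>0 (covers t vt)

length-≤-trues : ∀ {k} (v : Fin k → Bool) {ss : List (Fin k)} →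
                 Unique ss → All (λ t → v t ≡ true) ss → length ss ≤ trues v
length-≤-trues v {ss} unique all-true = begin
  length ss            ≡⟨ sum-occurrences ss ⟨
  sum (occurrences ss) ≤⟨ sum-mono-≤ (occurrences≤indicator unique all-true) ⟩
  trues v              ∎
  where
  open ≤-Reasoning
  occurrences≤indicator : ∀ {ss} → Unique ss → All (λ t → v t ≡ true) ss →
                          ∀ t → occurrences ss t ≤ (if v t then 1 else 0)
  occurrences≤indicator []                  []              t = z≤n
  occurrences≤indicator {s ∷ _} (s∉ ∷ uniq) (vs ∷ all-true) t with s ≟ t
  ... | yes refl rewrite vs | ∉⇒occurrences≡0 s∉ = s≤s z≤n
  ... | no  _    = occurrences≤indicator uniq all-true t

listSum-tabulate : ∀ {k} (f : Fin k → ℕ) → listSum (tabulate f) ≡ sum f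
listSum-tabulate {zero}  f = refl
listSum-tabulate {suc k} f = cong (f zero +_) (listSum-tabulate (f ∘ suc))

injective⇒surjective : ∀ {m n} → m ≡ n → (f : Fin m → Fin n) → (∀ {x y} → f x ≡ f y → x ≡ y) →
                       ∀ y → ∃ λ x → f x ≡ y
injective⇒surjective {suc m} refl f injective y with any? (λ x → f x ≟ y)
... | yes hit  = hit
... | no  miss = contradiction (injective⇒≤ {f = f′} f′-injective) 1+n≰n
  where
  f′ : Fin (suc m) → Fin m
  f′ x = punchOut {i = y} (λ e → miss (x , sym e))
  f′-injective : ∀ {x x′} → f′ x ≡ f′ x′ → x ≡ x′
  f′-injective e = injective (punchOut-injective {i = y} _ _ e)

lookup-injective : ∀ {A : Set} {xs : List A} → Unique xs → ∀ {i j} → lookup xs i ≡ lookup xs j → i ≡ j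
lookup-injective (_  ∷ _) {zero}  {zero}  _ = refl
lookup-injective (x∉ ∷ _) {zero}  {suc j} e = contradiction e (All.lookup x∉ (∈-lookup j))
lookup-injective (x∉ ∷ _) {suc i} {zero}  e = contradiction (sym e) (All.lookup x∉ (∈-lookup i))
lookup-injective (_  ∷ u) {suc i} {suc j} e = cong suc (lookup-injective u e)

module _ {n} (G : Graph n) where

  degree≡trues : ∀ v → degree G v ≡ trues (adj G v)
  degree≡trues v = trans (cong listSum (map-tabulate id indicator)) (listSum-tabulate indicator)
    where
    indicator : Fin n → ℕ
    indicator w = if adj G v w then 1 else 0

  adjacent⇒≢ : ∀ {x y} → adj G x y ≡ true → x ≢ y
  adjacent⇒≢ {x} xy refl = contradiction (trans (sym xy) (irrefl G x)) λ ()

  adjacent-sym : ∀ {x y} → adj G x y ≡ true → adj G y x ≡ true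
  adjacent-sym {x} {y} xy = trans (Graph.sym G y x) xy

  cyclicallyConsecutive : ∀ {k} {i j : Fin (suc k)} →
    suc (toℕ i) ≡ toℕ j ⊎ (suc (toℕ i) ≡ suc k × toℕ j ≡ 0) →
    (∃ λ s → i ≡ inject₁ s × j ≡ suc s) ⊎ (i ≡ fromℕ k × j ≡ zero)
  cyclicallyConsecutive {i = i} {suc s} (inj₁ e) =
    inj₁ (s , toℕ-injective (trans (suc-injective e) (sym (toℕ-inject₁ s))) , refl)
  cyclicallyConsecutive {k} {i} {zero} (inj₂ (e , _)) =
    inj₂ (toℕ-injective (trans (suc-injective e) (sym (toℕ-fromℕ k))) , refl)

  closedWalk⇒cycle : ∀ {k} (f : Fin (suc k) → Fin n) → 2 ≤ k → (∀ {i j} → f i ≡ f j → i ≡ j) →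
                     (∀ s → adj G (f (inject₁ s)) (f (suc s)) ≡ true) →
                     adj G (f (fromℕ k)) (f zero) ≡ true → IsCycle G (suc k) f
  closedWalk⇒cycle {k} f 2≤k injective path close = s≤s 2≤k , (λ _ _ → injective) , consecutive
    where
    consecutive : ∀ i j → suc (toℕ i) ≡ toℕ j ⊎ (suc (toℕ i) ≡ suc k × toℕ j ≡ 0) → adj G (f i) (f j) ≡ true
    consecutive i j e with cyclicallyConsecutive {i = i} {j} e
    ... | inj₁ (s , refl , refl) = path s
    ... | inj₂ (refl , refl)     = close

  module _ (girth≥5 : ∀ k f → IsCycle G k f → 5 ≤ k) where

    no-triangle : ∀ {x y z} → adj G x y ≡ true → adj G y z ≡ true → adj G z x ≡ true → ⊥
    no-triangle {x} {y} {z} xy yz zx =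
      contradiction (girth≥5 3 _ (closedWalk⇒cycle (lookup xs) (from-yes (2 ≤? 2)) (lookup-injective unique) path zx))
                    (from-no (5 ≤? 3))
      where
      xs : List (Fin n)
      xs = x ∷ y ∷ z ∷ []
      unique : Unique xs
      unique = (adjacent⇒≢ xy ∷ adjacent⇒≢ zx ∘ sym ∷ []) ∷ (adjacent⇒≢ yz ∷ []) ∷ [] ∷ []
      path : ∀ s → adj G (lookup xs (inject₁ s)) (lookup xs (suc s)) ≡ true
      path zero       = xy
      path (suc zero) = yz

    no-square : ∀ {w x y z} → adj G w x ≡ true → adj G x y ≡ true → adj G y z ≡ true →
                adj G z w ≡ true → w ≢ y → x ≢ z → ⊥
    no-square {w} {x} {y} {z} wx xy yz zw w≢y x≢z =
      contradiction (girth≥5 4 _ (closedWalk⇒cycle (lookup xs) (from-yes (2 ≤? 3)) (lookup-injective unique) path zw))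
                    (from-no (5 ≤? 4))
      where
      xs : List (Fin n)
      xs = w ∷ x ∷ y ∷ z ∷ []
      unique : Unique xs
      unique = (adjacent⇒≢ wx ∷ w≢y ∷ adjacent⇒≢ zw ∘ sym ∷ []) ∷ (adjacent⇒≢ xy ∷ x≢z ∷ [])
             ∷ (adjacent⇒≢ yz ∷ []) ∷ [] ∷ []
      path : ∀ s → adj G (lookup xs (inject₁ s)) (lookup xs (suc s)) ≡ true
      path zero             = wx
      path (suc zero)       = xy
      path (suc (suc zero)) = yz

module _ {n} (G : Graph n) {d} (regular : Regular G d) where

  open import Data.List.Membership.DecPropositional (_≟_ {n}) using (_∈?_)

  degree≡d : ∀ v → trues (adj G v) ≡ d
  degree≡d v = trans (sym (degree≡trues G v)) (regular v)

  neighbour-∉ : ∀ v (ws : List (Fin n)) → length ws < d → ∃ λ w → adj G v w ≡ true × w ∉ ws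
  neighbour-∉ v ws short with any? (λ w → (adj G v w ≟ᵇ true) ×-dec ¬? (w ∈? ws))
  ... | yes found = found
  ... | no  none  = contradiction (subst (_≤ length ws) (degree≡d v) (trues-≤-length (adj G v) ws covered))
                                  (<⇒≱ short)
    where
    covered : ∀ w → adj G v w ≡ true → w ∈ ws
    covered w vw with w ∈? ws
    ... | yes w∈ = w∈
    ... | no  w∉ = contradiction (w , vw , w∉) none

  neighbours-⊆ : ∀ v {ws} → Unique ws → All (λ w → adj G v w ≡ true) ws → length ws ≡ d →
                 ∀ w → adj G v w ≡ true → w ∈ ws
  neighbours-⊆ v {ws} unique adjacent full w vw with w ∈? ws
  ... | yes w∈ = w∈
  ... | no  w∉ = contradiction (subst₂ _≤_ (cong suc full) (degree≡d v) more) 1+n≰n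
    where
    more : suc (length ws) ≤ trues (adj G v)
    more = length-≤-trues (adj G v) (¬Any⇒All¬ ws w∉ ∷ unique) (vw ∷ adjacent)

  module _ {V : Set} (H : V → V → Bool) (φ : V → Fin n)
           (φ-injective : ∀ {p p′} → φ p ≡ φ p′ → p ≡ p′)
           (φ-preserves : ∀ {p p′} → H p p′ ≡ true → adj G (φ p) (φ p′) ≡ true) where

    φ-reflects : (neighbours : V → List V) → (∀ p → length (neighbours p) ≡ d) →
                 (∀ p → Unique (neighbours p)) → (∀ p → All (λ p′ → H p p′ ≡ true) (neighbours p)) →
                 ∀ p p′ → adj G (φ p) (φ p′) ≡ H p p′
    φ-reflects neighbours length≡d unique adjacent p p′ with H p p′ in h
    ... | true  = φ-preserves h
    ... | false with adj G (φ p) (φ p′) in g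
    ...   | false = refl
    ...   | true  = contradiction (trans (sym (All.lookup (adjacent p) p′∈)) h) λ ()
      where
      φp′∈ : φ p′ ∈ map φ (neighbours p)
      φp′∈ = neighbours-⊆ (φ p) (Unique.map⁺ φ-injective (unique p))
                          (All-map⁺ (All.map φ-preserves (adjacent p)))
                          (trans (length-map φ (neighbours p)) (length≡d p)) (φ p′) g
      p′∈ : p′ ∈ neighbours p
      p′∈ with x , x∈ , φp′≡φx ← ∈-map⁻ φ φp′∈ =
        subst (_∈ neighbours p) (sym (φ-injective φp′≡φx)) x∈

embedding⇒isomorphic : ∀ {n m} {G : Graph n} {V : Set} {H : V → V → Bool} (φ : V → Fin n) →
                       (∀ {p p′} → φ p ≡ φ p′ → p ≡ p′) → (Fin m ↔ V) → m ≡ n →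
                       (∀ p p′ → adj G (φ p) (φ p′) ≡ H p p′) → Isomorphic G H
embedding⇒isomorphic {n} {G = G} {V} φ φ-injective enumeration m≡n φ-adjacency =
  mk↔ₛ′ ψ φ ψφ φψ , λ x y → trans (cong₂ (adj G) (sym (φψ x)) (sym (φψ y))) (φ-adjacency (ψ x) (ψ y))
  where
  open Inverse enumeration using () renaming (to to enumerate; from to index; strictlyInverseʳ to index-enumerate)
  hit : ∀ x → ∃ λ k → φ (enumerate k) ≡ x
  hit = injective⇒surjective m≡n (φ ∘ enumerate)
          λ e → trans (sym (index-enumerate _)) (trans (cong index (φ-injective e)) (index-enumerate _))
  ψ : Fin n → V
  ψ x = enumerate (proj₁ (hit x))
  φψ : ∀ x → φ (ψ x) ≡ x
  φψ x = proj₂ (hit x)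
  ψφ : ∀ p → ψ (φ p) ≡ p
  ψφ p = φ-injective (φψ (φ p))

-- Congruence modulo d

infix 4 _≡_[mod_]
record _≡_[mod_] (m n d : ℕ) .{{_ : NonZero d}} : Set where
  constructor ≡-mod
  field %-≡ : m % d ≡ n % d
open _≡_[mod_] public

module _ {d : ℕ} .{{_ : NonZero d}} where

  ≡⇒≡-mod : ∀ {m n} → m ≡ n → m ≡ n [mod d ]
  ≡⇒≡-mod refl = ≡-mod refl

  ≡-mod-sym : ∀ {m n} → m ≡ n [mod d ] → n ≡ m [mod d ]
  ≡-mod-sym (≡-mod e) = ≡-mod (sym e)

  ≡-mod-trans : ∀ {m n o} → m ≡ n [mod d ] → n ≡ o [mod d ] → m ≡ o [mod d ]
  ≡-mod-trans (≡-mod e) (≡-mod f) = ≡-mod (trans e f)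

  ≡-mod-% : ∀ m → m % d ≡ m [mod d ]
  ≡-mod-% m = ≡-mod (m%n%n≡m%n m d)

  ≡-mod-+d : ∀ m → m + d ≡ m [mod d ]
  ≡-mod-+d m = ≡-mod ([m+n]%n≡m%n m d)

  ≡-mod-+ˡ : ∀ o {m n} → m ≡ n [mod d ] → o + m ≡ o + n [mod d ]
  ≡-mod-+ˡ o {m} {n} (≡-mod e) = ≡-mod (begin
    (o + m) % d           ≡⟨ %-distribˡ-+ o m d ⟩
    (o % d + m % d) % d   ≡⟨ cong (λ r → (o % d + r) % d) e ⟩
    (o % d + n % d) % d   ≡⟨ %-distribˡ-+ o n d ⟨
    (o + n) % d           ∎)
    where open ≡-Reasoning

  ≡-mod-+ʳ : ∀ o {m n} → m ≡ n [mod d ] → m + o ≡ n + o [mod d ]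
  ≡-mod-+ʳ o {m} {n} e =
    ≡-mod-trans (≡⇒≡-mod (+-comm m o)) (≡-mod-trans (≡-mod-+ˡ o e) (≡⇒≡-mod (+-comm o n)))

  ≡-mod-cancel-suc : ∀ {m n} → suc m ≡ suc n [mod d ] → m ≡ n [mod d ]
  ≡-mod-cancel-suc {m} {n} e =
    ≡-mod-trans (≡-mod-sym (≡-mod-+d m)) (≡-mod-trans (≡⇒≡-mod (shift m))
      (≡-mod-trans (≡-mod-+ˡ (pred d) e) (≡-mod-trans (≡⇒≡-mod (sym (shift n))) (≡-mod-+d n))))
    where
    shift : ∀ m → m + d ≡ pred d + suc m
    shift m = begin
      m + d              ≡⟨ cong (m +_) (suc-pred d) ⟨
      m + suc (pred d)   ≡⟨ +-comm m _ ⟩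
      suc (pred d) + m   ≡⟨ +-suc (pred d) m ⟨
      pred d + suc m     ∎
      where open ≡-Reasoning

  ≡-mod-cancel-+ˡ : ∀ o {m n} → o + m ≡ o + n [mod d ] → m ≡ n [mod d ]
  ≡-mod-cancel-+ˡ zero    e = e
  ≡-mod-cancel-+ˡ (suc o) e = ≡-mod-cancel-+ˡ o (≡-mod-cancel-suc e)

  ≡-mod-cancel-+ʳ : ∀ o {m n} → m + o ≡ n + o [mod d ] → m ≡ n [mod d ]
  ≡-mod-cancel-+ʳ o {m} {n} e =
    ≡-mod-cancel-+ˡ o (≡-mod-trans (≡⇒≡-mod (+-comm o m)) (≡-mod-trans e (≡⇒≡-mod (+-comm n o))))

  ≡-mod⇒≡ : ∀ {m n} → m < d → n < d → m ≡ n [mod d ] → m ≡ n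
  ≡-mod⇒≡ m<d n<d (≡-mod e) = trans (sym (m<n⇒m%n≡m m<d)) (trans e (m<n⇒m%n≡m n<d))

  toℕ-mod : ∀ i → toℕ (i mod d) ≡ i [mod d ]
  toℕ-mod i = ≡-mod-trans (≡⇒≡-mod (toℕ-fromℕ< _)) (≡-mod-% i)

  mod-toℕ : ∀ (a : Fin d) → toℕ a mod d ≡ a
  mod-toℕ a = toℕ-injective (trans (toℕ-fromℕ< _) (m<n⇒m%n≡m (toℕ<n a)))

  mod-cong : ∀ {i j} → i ≡ j [mod d ] → i mod d ≡ j mod d
  mod-cong (≡-mod e) = toℕ-injective (trans (toℕ-fromℕ< _) (trans e (sym (toℕ-fromℕ< _))))

  mod-injective : ∀ {i j} → i mod d ≡ j mod d → i ≡ j [mod d ]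
  mod-injective {i} {j} e =
    ≡-mod-trans (≡-mod-sym (toℕ-mod i)) (≡-mod-trans (≡⇒≡-mod (cong toℕ e)) (toℕ-mod j))

Close : ∀ d .{{_ : NonZero d}} → ℕ → ℕ → ℕ → Set
Close d m i k = ∃ λ δ → δ ≤ m × (k ≡ δ + i [mod d ] ⊎ i ≡ δ + k [mod d ])

module _ {d : ℕ} .{{_ : NonZero d}} where

  Close-sym : ∀ {m i k} → Close d m i k → Close d m k i
  Close-sym (δ , δ≤m , e) = δ , δ≤m , Sum.swap e

  Close-resp : ∀ {m i i′ k k′} → i ≡ i′ [mod d ] → k ≡ k′ [mod d ] → Close d m i k → Close d m i′ k′
  Close-resp i≡ k≡ (δ , δ≤m , e) =
    δ , δ≤m , Sum.map (λ e → ≡-mod-trans (≡-mod-sym k≡) (≡-mod-trans e (≡-mod-+ˡ δ i≡)))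
                      (λ e → ≡-mod-trans (≡-mod-sym i≡) (≡-mod-trans e (≡-mod-+ˡ δ k≡))) e

  arc≤⇒Close : ∀ {a b m} → a ≤ b → b < d → (b ∸ a) ⊓ (d ∸ (b ∸ a)) ≤ m → Close d m a b
  arc≤⇒Close {a} {b} {m} a≤b b<d short with ⊓-sel (b ∸ a) (d ∸ (b ∸ a))
  ... | inj₁ e = b ∸ a , subst (_≤ m) e short , inj₁ (≡⇒≡-mod (sym (m∸n+n≡m a≤b)))
  ... | inj₂ e = d ∸ (b ∸ a) , subst (_≤ m) e short ,
                 inj₂ (≡-mod-sym (≡-mod-trans (≡⇒≡-mod around) (≡-mod-+d a)))
    where
    around : (d ∸ (b ∸ a)) + b ≡ a + d
    around = begin
      (d ∸ (b ∸ a)) + b               ≡⟨ cong ((d ∸ (b ∸ a)) +_) (m∸n+n≡m a≤b) ⟨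
      (d ∸ (b ∸ a)) + ((b ∸ a) + a)   ≡⟨ +-assoc (d ∸ (b ∸ a)) (b ∸ a) a ⟨
      (d ∸ (b ∸ a)) + (b ∸ a) + a     ≡⟨ cong (_+ a) (m∸n+n≡m (≤-trans (m∸n≤m b a) (<⇒≤ b<d))) ⟩
      d + a                           ≡⟨ +-comm d a ⟩
      a + d                           ∎
      where open ≡-Reasoning

  cycleDist≤⇒Close : ∀ {n} (G : Graph n) (a b : Fin d) {m} →
                     cycleDist G d a b ≤ m → Close d m (toℕ a) (toℕ b)
  cycleDist≤⇒Close G a b {m} short with ≤-total (toℕ a) (toℕ b)
  ... | inj₁ a≤b = arc≤⇒Close a≤b (toℕ<n b)
                     (subst (λ e → e ⊓ (d ∸ e) ≤ m) (m≤n⇒∣m-n∣≡n∸m a≤b) short)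
  ... | inj₂ b≤a = Close-sym (arc≤⇒Close b≤a (toℕ<n a)
                     (subst (λ e → e ⊓ (d ∸ e) ≤ m) (m≤n⇒∣n-m∣≡n∸m b≤a) short))

-- Chord sequences

-- The chords X m X (m + 2) and X m X (m + 3) of F(3,5,q), with the copies of P − uv starting at multiples of 5.
chordPattern₂ chordPattern₃ : ℕ → Bool
chordPattern₂ 0 = true
chordPattern₂ 1 = true
chordPattern₂ 2 = true
chordPattern₂ 3 = false
chordPattern₂ 4 = false
chordPattern₂ (suc (suc (suc (suc (suc m))))) = chordPattern₂ m
chordPattern₃ 0 = true
chordPattern₃ 1 = true
chordPattern₃ 2 = false
chordPattern₃ 3 = false
chordPattern₃ 4 = false
chordPattern₃ (suc (suc (suc (suc (suc m))))) = chordPattern₃ m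

chordPattern₂≡not-chordPattern₃ : ∀ m → chordPattern₂ m ≡ not (chordPattern₃ (2 + m))
chordPattern₂≡not-chordPattern₃ 0 = refl
chordPattern₂≡not-chordPattern₃ 1 = refl
chordPattern₂≡not-chordPattern₃ 2 = refl
chordPattern₂≡not-chordPattern₃ 3 = refl
chordPattern₂≡not-chordPattern₃ 4 = refl
chordPattern₂≡not-chordPattern₃ (suc (suc (suc (suc (suc m))))) = chordPattern₂≡not-chordPattern₃ m

chordPattern₂-+*5 : ∀ k m → chordPattern₂ (k * 5 + m) ≡ chordPattern₂ m
chordPattern₂-+*5 zero    m = refl
chordPattern₂-+*5 (suc k) m = chordPattern₂-+*5 k m

chordPattern₃-+*5 : ∀ k m → chordPattern₃ (k * 5 + m) ≡ chordPattern₃ m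
chordPattern₃-+*5 zero    m = refl
chordPattern₃-+*5 (suc k) m = chordPattern₃-+*5 k m

chordPattern₂-shift : ∀ s k → chordPattern₂ (s + k * 5) ≡ chordPattern₂ s
chordPattern₂-shift s k = trans (cong chordPattern₂ (+-comm s (k * 5))) (chordPattern₂-+*5 k s)

chordPattern₃-shift : ∀ s k → chordPattern₃ (s + k * 5) ≡ chordPattern₃ s
chordPattern₃-shift s k = trans (cong chordPattern₃ (+-comm s (k * 5))) (chordPattern₃-+*5 k s)

chordPattern₃-period : ∀ t → (∀ m → chordPattern₃ (t + m) ≡ chordPattern₃ m) → 5 ∣ t
chordPattern₃-period t periodic = m%n≡0⇒n∣m t 5 (residue (t % 5) (m%n<n t 5) reduced)
  where
  reduced : ∀ m → chordPattern₃ (t % 5 + m) ≡ chordPattern₃ m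
  reduced m = begin
    chordPattern₃ (t % 5 + m)                ≡⟨ chordPattern₃-+*5 (t / 5) (t % 5 + m) ⟨
    chordPattern₃ (t / 5 * 5 + (t % 5 + m))  ≡⟨ cong chordPattern₃ (+-assoc (t / 5 * 5) (t % 5) m) ⟨
    chordPattern₃ (t / 5 * 5 + t % 5 + m)    ≡⟨ cong (λ x → chordPattern₃ (x + m)) (+-comm (t / 5 * 5) (t % 5)) ⟩
    chordPattern₃ (t % 5 + t / 5 * 5 + m)    ≡⟨ cong (λ x → chordPattern₃ (x + m)) (m≡m%n+[m/n]*n t 5) ⟨
    chordPattern₃ (t + m)                    ≡⟨ periodic m ⟩
    chordPattern₃ m                          ∎
    where open ≡-Reasoning
  residue : ∀ s → s < 5 → (∀ m → chordPattern₃ (s + m) ≡ chordPattern₃ m) → s ≡ 0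
  residue 0 _ _     = refl
  residue 1 _ shift = contradiction (shift 1) λ ()
  residue 2 _ shift = contradiction (shift 0) λ ()
  residue 3 _ shift = contradiction (shift 0) λ ()
  residue 4 _ shift = contradiction (shift 0) λ ()
  residue (suc (suc (suc (suc (suc _))))) (s≤s (s≤s (s≤s (s≤s (s≤s ()))))) _

antitone⇒periodic : ∀ (f : ℕ → Bool) s p → (∀ i → f (suc p + i) ≡ f i) →
                    (∀ i → f (s + i) ≡ true → f i ≡ true) → ∀ i → f (s + i) ≡ f i
antitone⇒periodic f s p periodic antitone i with f i in fi
... | false = ¬-not λ f[s+i] → contradiction (trans (sym (antitone i f[s+i])) fi) λ ()
... | true  = descend p (trans (cong (λ x → f (x + i)) (*-comm s (suc p))) (trans (periodic* s) fi))
  where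
  periodic* : ∀ k → f (suc p * k + i) ≡ f i
  periodic* zero    = cong (λ x → f (x + i)) (*-zeroʳ p)
  periodic* (suc k) = begin
    f (suc p * suc k + i)          ≡⟨ cong (λ x → f (x + i)) (*-suc (suc p) k) ⟩
    f (suc p + suc p * k + i)      ≡⟨ cong f (+-assoc (suc p) (suc p * k) i) ⟩
    f (suc p + (suc p * k + i))    ≡⟨ periodic _ ⟩
    f (suc p * k + i)              ≡⟨ periodic* k ⟩
    f i                            ∎
    where open ≡-Reasoning
  descend : ∀ k → f (s * suc k + i) ≡ true → f (s + i) ≡ true
  descend zero    f[s+i]    = subst (λ x → f (x + i) ≡ true) (*-identityʳ s) f[s+i]
  descend (suc k) f[s*k′+i] = descend k (antitone _ (subst (λ x → f x ≡ true) shift f[s*k′+i]))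
    where
    shift : s * suc (suc k) + i ≡ s + (s * suc k + i)
    shift = trans (cong (_+ i) (*-suc s (suc k))) (+-assoc s (s * suc k) i)

two-of-four : ∀ {a₃ b₃ a₁ b₀} → 2 ≤ trues (Vec.lookup (a₃ ∷ b₃ ∷ a₁ ∷ b₀ ∷ [])) →
              (b₀ ≡ true → a₃ ≡ true → ⊥) → (b₀ ≡ true → b₃ ≡ true → ⊥) → (a₁ ≡ true → b₃ ≡ true → ⊥) →
              a₃ ≡ not b₀ × (b₀ ≡ true → a₁ ≡ true)
two-of-four {true}  {_}     {_}     {true}  _        no-b-a _      _      = ⊥-elim (no-b-a refl refl)
two-of-four {false} {true}  {_}     {true}  _        _      no-b-b _      = ⊥-elim (no-b-b refl refl)
two-of-four {false} {false} {false} {true}  (s≤s ()) _      _      _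
two-of-four {false} {false} {true}  {true}  _        _      _      _      = refl , λ _ → refl
two-of-four {true}  {_}     {_}     {false} _        _      _      _      = refl , λ ()
two-of-four {false} {true}  {true}  {false} _        _      _      no-a-b = ⊥-elim (no-a-b refl refl)
two-of-four {false} {true}  {false} {false} (s≤s ()) _      _      _
two-of-four {false} {false} {true}  {false} (s≤s ()) _      _      _
two-of-four {false} {false} {false} {false} ()       _      _      _

module ChordSequences (a b : ℕ → Bool)
  (two : ∀ i → 2 ≤ trues (Vec.lookup (a (3 + i) ∷ b (3 + i) ∷ a (1 + i) ∷ b i ∷ [])))
  (no-b-b : ∀ i → b i ≡ true → b (3 + i) ≡ true → ⊥)
  (no-a-b : ∀ i → a i ≡ true → b (2 + i) ≡ true → ⊥)
  (no-b-a : ∀ i → b i ≡ true → a (3 + i) ≡ true → ⊥)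
  (no-a-a-a : ∀ i → a i ≡ true → a (2 + i) ≡ true → a (4 + i) ≡ true → ⊥)
  (p : ℕ) (b-periodic : ∀ i → b (suc p + i) ≡ b i) where

  a≡not-b : ∀ i → a (3 + i) ≡ not (b i)
  a≡not-b i = proj₁ (two-of-four (two i) (no-b-a i) (no-b-b i) (no-a-b (1 + i)))

  b⇒a : ∀ i → b i ≡ true → a (1 + i) ≡ true
  b⇒a i = proj₂ (two-of-four (two i) (no-b-a i) (no-b-b i) (no-a-b (1 + i)))

  no-b-b₂ : ∀ i → b i ≡ true → b (2 + i) ≡ true → ⊥
  no-b-b₂ i bᵢ b₂₊ᵢ =
    contradiction (trans (sym (b⇒a (2 + i) b₂₊ᵢ)) (trans (a≡not-b i) (cong not bᵢ))) λ ()

  no-gaps : ∀ i → b i ≡ false → b (2 + i) ≡ false → b (4 + i) ≡ false → ⊥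
  no-gaps i bᵢ b₂₊ᵢ b₄₊ᵢ = no-a-a-a (3 + i) (a-true bᵢ) (a-true b₂₊ᵢ) (a-true b₄₊ᵢ)
    where
    a-true : ∀ {j} → b j ≡ false → a (3 + j) ≡ true
    a-true {j} bⱼ = trans (a≡not-b j) (cong not bⱼ)

  b-antitone : ∀ i → b (5 + i) ≡ true → b i ≡ true
  b-antitone i b₅₊ᵢ with b i in bᵢ
  ... | true  = refl
  ... | false = ⊥-elim (no-a-b (3 + i) (trans (a≡not-b i) (cong not bᵢ)) b₅₊ᵢ)

  b-period₅ : ∀ i → b (5 + i) ≡ b i
  b-period₅ = antitone⇒periodic b 5 p b-periodic b-antitone

  some-b : ∃ λ k → b k ≡ true
  some-b with b 0 in b₀ | b 2 in b₂ | b 4 in b₄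
  ... | true  | _     | _     = 0 , b₀
  ... | false | true  | _     = 2 , b₂
  ... | false | false | true  = 4 , b₄
  ... | false | false | false = ⊥-elim (no-gaps 0 b₀ b₂ b₄)

  consecutive-b : ∀ k → b k ≡ true → ∃ λ r → b r ≡ true × b (1 + r) ≡ true
  consecutive-b k bₖ with b (1 + k) in b₁₊ₖ
  ... | true  = k , bₖ , b₁₊ₖ
  ... | false with b (4 + k) in b₄₊ₖ
  ...   | true  = 4 + k , b₄₊ₖ , trans (b-period₅ k) bₖ
  ...   | false = ⊥-elim (no-gaps (2 + k) (¬-not (no-b-b₂ k bₖ)) b₄₊ₖ (trans (b-period₅ (1 + k)) b₁₊ₖ))

  b-pattern : ∀ {r} → b r ≡ true → b (1 + r) ≡ true → ∀ m → b (m + r) ≡ chordPattern₃ m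
  b-pattern bᵣ _    0 = bᵣ
  b-pattern _  b₁₊ᵣ 1 = b₁₊ᵣ
  b-pattern bᵣ _    2 = ¬-not (no-b-b₂ _ bᵣ)
  b-pattern bᵣ _    3 = ¬-not (no-b-b _ bᵣ)
  b-pattern _  b₁₊ᵣ 4 = ¬-not (no-b-b _ b₁₊ᵣ)
  b-pattern {r} bᵣ b₁₊ᵣ (suc (suc (suc (suc (suc m))))) = trans (b-period₅ (m + r)) (b-pattern bᵣ b₁₊ᵣ m)

  -- The phase is 5 + r rather than r so that every a (m + 5 + r) is an instance of a≡not-b.
  phase : ∃ λ r → ∀ m → a (m + r) ≡ chordPattern₂ m × b (m + r) ≡ chordPattern₃ m
  phase with r , bᵣ , b₁₊ᵣ ← consecutive-b _ (proj₂ some-b) = 5 + r , λ m → a-part m , b-part m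
    where
    shift : ∀ m → m + (5 + r) ≡ 5 + (m + r)
    shift m = trans (sym (+-assoc m 5 r)) (cong (_+ r) (+-comm m 5))
    b-part : ∀ m → b (m + (5 + r)) ≡ chordPattern₃ m
    b-part m = trans (cong b (shift m)) (trans (b-period₅ (m + r)) (b-pattern bᵣ b₁₊ᵣ m))
    a-part : ∀ m → a (m + (5 + r)) ≡ chordPattern₂ m
    a-part m = begin
      a (m + (5 + r))               ≡⟨ cong a (shift m) ⟩
      a (3 + (2 + m + r))           ≡⟨ a≡not-b (2 + m + r) ⟩
      not (b (2 + m + r))           ≡⟨ cong not (b-pattern bᵣ b₁₊ᵣ (2 + m)) ⟩
      not (chordPattern₃ (2 + m))   ≡⟨ chordPattern₂≡not-chordPattern₃ m ⟨
      chordPattern₂ m               ∎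
      where open ≡-Reasoning

  5∣period : 5 ∣ suc p
  5∣period = chordPattern₃-period (suc p) λ m → begin
    chordPattern₃ (suc p + m)   ≡⟨ b-part (suc p + m) ⟨
    b (suc p + m + r)           ≡⟨ cong b (+-assoc (suc p) m r) ⟩
    b (suc p + (m + r))         ≡⟨ b-periodic (m + r) ⟩
    b (m + r)                   ≡⟨ b-part m ⟩
    chordPattern₃ m             ∎
    where
    open ≡-Reasoning
    r : ℕ
    r = proj₁ phase
    b-part : ∀ m → b (m + r) ≡ chordPattern₃ m
    b-part m = proj₂ (proj₂ phase m)

-- The graph F(3,5,q)

≡ᵇ-refl : ∀ m → (m ≡ᵇ m) ≡ true
≡ᵇ-refl zero    = refl
≡ᵇ-refl (suc m) = ≡ᵇ-refl m

blockNeighbours : Fin 10 → List (Fin 10)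
blockNeighbours a = filter (λ a′ → T? (petMinusUVℕ (toℕ a) (toℕ a′))) (allFin 10)

crossLabels : Fin 10 → List (Fin 10)
crossLabels 0F = 1F ∷ []
crossLabels 1F = 0F ∷ []
crossLabels _  = []

petersenNeighbours : Fin 10 → List (Fin 10)
petersenNeighbours a = blockNeighbours a ++ crossLabels a

petersenNeighbours-length : ∀ a → length (petersenNeighbours a) ≡ 3
petersenNeighbours-length = from-yes (all? λ a → length (petersenNeighbours a) ≟ℕ 3)

petersenNeighbours-unique : ∀ a → Unique (petersenNeighbours a)
petersenNeighbours-unique = from-yes (all? λ a → unique? (petersenNeighbours a))

module _ {k : ℕ} where

  cyclicPred : Fin (suc k) → Fin (suc k)
  cyclicPred zero    = fromℕ k
  cyclicPred (suc i) = inject₁ i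

  cyclicSuc : Fin (suc k) → Fin (suc k)
  cyclicSuc i with toℕ i ≟ℕ k
  ... | yes _   = zero
  ... | no  i≢k = suc (lower₁ i (i≢k ∘ sym))

  succMod-cyclicPred : ∀ i → succMod (suc k) (cyclicPred i) i ≡ true
  succMod-cyclicPred zero    rewrite toℕ-fromℕ k | ≡ᵇ-refl k = refl
  succMod-cyclicPred (suc i) rewrite toℕ-inject₁ i | ≡ᵇ-refl (toℕ i) = refl

  succMod-cyclicSuc : ∀ i → succMod (suc k) i (cyclicSuc i) ≡ true
  succMod-cyclicSuc i with toℕ i ≟ℕ k
  ... | yes i≡k rewrite i≡k | ≡ᵇ-refl k = refl
  ... | no  i≢k rewrite toℕ-lower₁ i (i≢k ∘ sym) | ≡ᵇ-refl (toℕ i) = refl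

  FAdj-block : ∀ i {a a′} → petMinusUVℕ (toℕ a) (toℕ a′) ≡ true → FAdj (suc k) (i , a) (i , a′) ≡ true
  FAdj-block i pet rewrite ≡ᵇ-refl (toℕ i) | pet = refl

  FAdj-cyclicPred : ∀ i → FAdj (suc k) (i , 0F) (cyclicPred i , 1F) ≡ true
  FAdj-cyclicPred i rewrite succMod-cyclicPred i = ∨-zeroʳ _

  FAdj-cyclicSuc : ∀ i → FAdj (suc k) (i , 1F) (cyclicSuc i , 0F) ≡ true
  FAdj-cyclicSuc i rewrite succMod-cyclicSuc i = ∨-zeroʳ _

  crossNeighbours : Fin (suc k) → Fin 10 → List (Fin (suc k) × Fin 10)
  crossNeighbours i 0F = (cyclicPred i , 1F) ∷ []
  crossNeighbours i 1F = (cyclicSuc i , 0F) ∷ []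
  crossNeighbours i _  = []

  FNeighbours : Fin (suc k) × Fin 10 → List (Fin (suc k) × Fin 10)
  FNeighbours (i , a) = map (i ,_) (blockNeighbours a) ++ crossNeighbours i a

  labels-FNeighbours : ∀ p → map proj₂ (FNeighbours p) ≡ petersenNeighbours (proj₂ p)
  labels-FNeighbours (i , a) = begin
    map proj₂ (map (i ,_) (blockNeighbours a) ++ crossNeighbours i a)
      ≡⟨ map-++ proj₂ (map (i ,_) (blockNeighbours a)) (crossNeighbours i a) ⟩
    map proj₂ (map (i ,_) (blockNeighbours a)) ++ map proj₂ (crossNeighbours i a)
      ≡⟨ cong₂ _++_ (trans (sym (map-∘ (blockNeighbours a))) (map-id (blockNeighbours a))) (cross a) ⟩
    blockNeighbours a ++ crossLabels a
      ∎
    where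
    open ≡-Reasoning
    cross : ∀ a → map proj₂ (crossNeighbours i a) ≡ crossLabels a
    cross 0F            = refl
    cross 1F            = refl
    cross (suc (suc _)) = refl

  FNeighbours-length : ∀ p → length (FNeighbours p) ≡ 3
  FNeighbours-length p = trans (sym (length-map proj₂ (FNeighbours p)))
                               (trans (cong length (labels-FNeighbours p)) (petersenNeighbours-length (proj₂ p)))

  FNeighbours-unique : ∀ p → Unique (FNeighbours p)
  FNeighbours-unique p =
    Unique.map⁻ (subst Unique (sym (labels-FNeighbours p)) (petersenNeighbours-unique (proj₂ p)))

  FNeighbours-adjacent : ∀ p → All (λ p′ → FAdj (suc k) p p′ ≡ true) (FNeighbours p)
  FNeighbours-adjacent (i , a) =
    ++⁺ (All-map⁺ (All.map (λ {a′} → FAdj-block i {a} {a′} ∘ T-≡ .to) inBlock)) (cross a)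
    where
    inBlock : All (λ a′ → T (petMinusUVℕ (toℕ a) (toℕ a′))) (blockNeighbours a)
    inBlock = all-filter (λ a′ → T? (petMinusUVℕ (toℕ a) (toℕ a′))) (allFin 10)
    cross : ∀ a → All (λ p′ → FAdj (suc k) (i , a) p′ ≡ true) (crossNeighbours i a)
    cross 0F            = FAdj-cyclicPred i ∷ []
    cross 1F            = FAdj-cyclicSuc i ∷ []
    cross (suc (suc _)) = []

data Layer : Set where
  outer inner : Layer

_≟ˡ_ : (ℓ ℓ′ : Layer) → Dec (ℓ ≡ ℓ′)
outer ≟ˡ outer = yes refl
outer ≟ˡ inner = no λ ()
inner ≟ˡ outer = no λ ()
inner ≟ˡ inner = yes refl

-- Read backwards from u = 0, the outer 5-cycle of P ends in v = 1, so that the edge v_i u_{i+1} of F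
-- continues it; each inner vertex takes the position of its outer neighbour.
label : Fin 10 → Layer × Fin 5
label 0F = outer , 0F
label 1F = outer , 4F
label 2F = outer , 3F
label 3F = outer , 2F
label 4F = outer , 1F
label 5F = inner , 0F
label 6F = inner , 4F
label 7F = inner , 3F
label 8F = inner , 2F
label 9F = inner , 1F

label-injective : ∀ a a′ → label a ≡ label a′ → a ≡ a′
label-injective = from-yes (all? λ a → all? λ a′ → ≡-dec _≟ˡ_ _≟_ (label a) (label a′) →-dec a ≟ a′)

layer : Fin 10 → Layer
layer = proj₁ ∘ label

position : Fin 10 → ℕ
position = toℕ ∘ proj₂ ∘ label

-- The edges of P − uv in the coordinates given by label.
blockAdj : Layer → ℕ → Layer → ℕ → Bool
blockAdj outer s outer s′ = (s′ ≡ᵇ suc s) ∨ (s ≡ᵇ suc s′)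
blockAdj outer s inner s′ = s ≡ᵇ s′
blockAdj inner s outer s′ = s ≡ᵇ s′
blockAdj inner s inner s′ = ((s′ ≡ᵇ 2 + s) ∧ chordPattern₂ s) ∨ ((s′ ≡ᵇ 3 + s) ∧ chordPattern₃ s)
                          ∨ ((s ≡ᵇ 2 + s′) ∧ chordPattern₂ s′) ∨ ((s ≡ᵇ 3 + s′) ∧ chordPattern₃ s′)

petersen-block : ∀ a a′ → T (petMinusUVℕ (toℕ a) (toℕ a′)) →
                 T (blockAdj (layer a) (position a) (layer a′) (position a′))
petersen-block = from-yes (all? λ a → all? λ a′ →
  T? (petMinusUVℕ (toℕ a) (toℕ a′)) →-dec T? (blockAdj (layer a) (position a) (layer a′) (position a′)))

-- Equatorial graphs

-- q′ = q - 1, so C (i + q′) is the predecessor of C i on the cycle.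
module Equatorial {n} {G : Graph n} (regular : Regular G 3) (girth≥5 : ∀ k f → IsCycle G k f → 5 ≤ k)
  {q′ : ℕ} (c : Fin (suc q′) → Fin n) (isometric : IsIsometricCycle G (suc q′) c)
  (12≤q : 12 ≤ suc q′) (n≡2q : n ≡ 2 * suc q′) where

  q : ℕ
  q = suc q′

  infix 4 _~_
  _~_ : Fin n → Fin n → Set
  v ~ w = adj G v w ≡ true

  offset-injective : ∀ a b {i} {_ : True (a ≤? 11)} {_ : True (b ≤? 11)} → a + i ≡ b + i [mod q ] → a ≡ b
  offset-injective a b {i} {a≤11} {b≤11} e =
    ≡-mod⇒≡ (≤-trans (s≤s (toWitness a≤11)) 12≤q) (≤-trans (s≤s (toWitness b≤11)) 12≤q) (≡-mod-cancel-+ʳ i e)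

  C : ℕ → Fin n
  C i = c (i mod q)

  C-cong : ∀ {i j} → i ≡ j [mod q ] → C i ≡ C j
  C-cong e = cong c (mod-cong e)

  C-injective : ∀ {i j} → C i ≡ C j → i ≡ j [mod q ]
  C-injective e = mod-injective (proj₁ (proj₂ (proj₁ isometric)) _ _ e)

  C-adjacent : ∀ i → C i ~ C (suc i)
  C-adjacent i = proj₂ (proj₂ (proj₁ isometric)) (i mod q) (suc i mod q) consecutive
    where
    suc-mod : suc i % q ≡ suc (i % q) % q
    suc-mod = %-≡ (≡-mod-+ˡ {d = q} 1 (≡-mod-sym (≡-mod-% i)))
    consecutive : suc (toℕ (i mod q)) ≡ toℕ (suc i mod q) ⊎ (suc (toℕ (i mod q)) ≡ q × toℕ (suc i mod q) ≡ 0)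
    consecutive rewrite toℕ-fromℕ< (m%n<n i q) | toℕ-fromℕ< (m%n<n (suc i) q)
      with m≤n⇒m<n∨m≡n (m%n<n i q)
    ... | inj₁ i%q+1<q = inj₁ (sym (trans suc-mod (m<n⇒m%n≡m i%q+1<q)))
    ... | inj₂ i%q+1≡q = inj₂ (i%q+1≡q , trans suc-mod (trans (cong (_% q) i%q+1≡q) (n%n≡0 q)))

  suc-pred-mod : ∀ i → suc (i + q′) ≡ i [mod q ]
  suc-pred-mod i = ≡-mod-trans (≡⇒≡-mod (sym (+-suc i q′))) (≡-mod-+d i)

  C-adjacent-pred : ∀ i → C i ~ C (i + q′)
  C-adjacent-pred i = adjacent-sym G (subst (C (i + q′) ~_) (C-cong (suc-pred-mod i)) (C-adjacent (i + q′)))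

  C-walk : ∀ {i k m} → Walk G (C i) (C k) m → Close q m i k
  C-walk {i} {k} {m} w = Close-resp (toℕ-mod i) (toℕ-mod k)
    (cycleDist≤⇒Close G (i mod q) (k mod q) (proj₂ (proj₂ isometric (i mod q) (k mod q)) m w))

  C-isometric : ∀ {i a m} → a + a ≤ q → Walk G (C i) (C (a + i)) m → a ≤ m
  C-isometric {i} {a} {m} 2a≤q w with a ≤? m | C-walk w
  ... | yes a≤m | _ = a≤m
  ... | no  a≰m | δ , δ≤m , inj₁ e = subst (_≤ m) (sym (≡-mod⇒≡ a<q δ<q (≡-mod-cancel-+ʳ i e))) δ≤m
    where
    a<q : a < q
    a<q = <-≤-trans (m<m+n a (≤-<-trans z≤n (≰⇒> a≰m))) 2a≤q
    δ<q : δ < q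
    δ<q = ≤-<-trans δ≤m (<-trans (≰⇒> a≰m) a<q)
  ... | no  a≰m | δ , δ≤m , inj₂ e = subst (_≤ m) (sym (m+n≡0⇒n≡0 δ (sym 0≡δ+a))) z≤n
    where
    δ+a<q : δ + a < q
    δ+a<q = <-≤-trans (+-monoˡ-< a (≤-<-trans δ≤m (≰⇒> a≰m))) 2a≤q
    0≡δ+a : 0 ≡ δ + a
    0≡δ+a = ≡-mod⇒≡ (≤-<-trans z≤n δ+a<q) δ+a<q
              (≡-mod-cancel-+ʳ i (≡-mod-trans e (≡⇒≡-mod (sym (+-assoc δ a i)))))

  opaque
    thirdNeighbour : ∀ (k : Fin q) → ∃ λ w → c k ~ w × w ∉ C (suc (toℕ k)) ∷ C (toℕ k + q′) ∷ []
    thirdNeighbour k =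
      neighbour-∉ G regular (c k) (C (suc (toℕ k)) ∷ C (toℕ k + q′) ∷ []) (from-yes (2 <? 3))

    X : ℕ → Fin n
    X i = proj₁ (thirdNeighbour (i mod q))

    X-cong : ∀ {i j} → i ≡ j [mod q ] → X i ≡ X j
    X-cong e = cong (proj₁ ∘ thirdNeighbour) (mod-cong e)

    C~X : ∀ i → C i ~ X i
    C~X i = proj₁ (proj₂ (thirdNeighbour (i mod q)))

    X≢C-suc : ∀ i → X i ≢ C (suc i)
    X≢C-suc i e = proj₂ (proj₂ (thirdNeighbour (i mod q)))
      (here (trans e (C-cong (≡-mod-+ˡ 1 (≡-mod-sym (toℕ-mod i))))))

    X-suc≢C : ∀ i → X (suc i) ≢ C i
    X-suc≢C i e = proj₂ (proj₂ (thirdNeighbour (suc i mod q))) (there (here (trans e (C-cong pred-mod))))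
      where
      pred-mod : i ≡ toℕ (suc i mod q) + q′ [mod q ]
      pred-mod = ≡-mod-sym (≡-mod-trans (≡-mod-+ʳ q′ (toℕ-mod (suc i))) (suc-pred-mod i))

  X~C : ∀ i → X i ~ C i
  X~C i = adjacent-sym G (C~X i)

  X≢C : ∀ i k → X i ≢ C k
  X≢C i k e with C-walk {i} {k} (step (subst (C i ~_) e (C~X i)) here)
  ... | zero        , _      , inj₁ k≡i   = adjacent⇒≢ G (C~X i) (trans (C-cong (≡-mod-sym k≡i)) (sym e))
  ... | zero        , _      , inj₂ i≡k   = adjacent⇒≢ G (C~X i) (trans (C-cong i≡k) (sym e))
  ... | suc zero    , _      , inj₁ k≡1+i = X≢C-suc i (trans e (C-cong k≡1+i))
  ... | suc zero    , _      , inj₂ i≡1+k = X-suc≢C k (trans (X-cong (≡-mod-sym i≡1+k)) e)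
  ... | suc (suc _) , s≤s () , _

  C≢C₂ : ∀ i → C i ≢ C (2 + i)
  C≢C₂ i e = contradiction (offset-injective 0 2 (C-injective e)) λ ()

  private
    X-injective-offset : ∀ {i k δ} → k ≡ δ + i [mod q ] → δ ≤ 2 → X i ≡ X k → δ ≡ 0
    X-injective-offset {δ = zero} _ _ _ = refl
    X-injective-offset {i} {k} {suc zero} k≡1+i _ e = ⊥-elim (no-triangle G girth≥5
      (C-adjacent i) (subst (C (suc i) ~_) (sym (trans e (X-cong k≡1+i))) (C~X (suc i))) (X~C i))
    X-injective-offset {i} {k} {suc (suc zero)} k≡2+i _ e = ⊥-elim (no-square G girth≥5
      (C-adjacent i) (C-adjacent (suc i)) (subst (C (2 + i) ~_) (sym (trans e (X-cong k≡2+i))) (C~X (2 + i)))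
      (X~C i) (C≢C₂ i) (X≢C i (suc i) ∘ sym))
    X-injective-offset {δ = suc (suc (suc _))} _ (s≤s (s≤s ())) _

  X-injective : ∀ {i k} → X i ≡ X k → i ≡ k [mod q ]
  X-injective {i} {k} e with C-walk {i} {k} (step (C~X i) (step (subst (_~ C k) (sym e) (X~C k)) here))
  ... | δ , δ≤2 , inj₁ k≡δ+i with refl ← X-injective-offset k≡δ+i δ≤2 e = ≡-mod-sym k≡δ+i
  ... | δ , δ≤2 , inj₂ i≡δ+k with refl ← X-injective-offset i≡δ+k δ≤2 (sym e) = i≡δ+k

  private
    X~X-offset : ∀ {i k δ} → k ≡ δ + i [mod q ] → δ ≤ 3 → X i ~ X k → δ ≡ 2 ⊎ δ ≡ 3
    X~X-offset {i} {k} {zero} k≡i _ xx = ⊥-elim (adjacent⇒≢ G xx (X-cong (≡-mod-sym k≡i)))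
    X~X-offset {i} {k} {suc zero} k≡1+i _ xx = ⊥-elim (no-square G girth≥5
      (C-adjacent i) (C~X (suc i)) (adjacent-sym G (subst (X i ~_) (X-cong k≡1+i) xx)) (X~C i)
      (X≢C (suc i) i ∘ sym) (X≢C i (suc i) ∘ sym))
    X~X-offset {δ = suc (suc zero)}        _ _ _ = inj₁ refl
    X~X-offset {δ = suc (suc (suc zero))}  _ _ _ = inj₂ refl
    X~X-offset {δ = suc (suc (suc (suc _)))} _ (s≤s (s≤s (s≤s ()))) _

  X~X : ∀ {i k} → X i ~ X k →
        k ≡ 2 + i [mod q ] ⊎ k ≡ 3 + i [mod q ] ⊎ i ≡ 2 + k [mod q ] ⊎ i ≡ 3 + k [mod q ]
  X~X {i} {k} xx with C-walk {i} {k} (step (C~X i) (step xx (step (X~C k) here)))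
  ... | δ , δ≤3 , inj₁ k≡δ+i with X~X-offset k≡δ+i δ≤3 xx
  ...   | inj₁ refl = inj₁ k≡δ+i
  ...   | inj₂ refl = inj₂ (inj₁ k≡δ+i)
  X~X {i} {k} xx | δ , δ≤3 , inj₂ i≡δ+k with X~X-offset i≡δ+k δ≤3 (adjacent-sym G xx)
  ...   | inj₁ refl = inj₂ (inj₂ (inj₁ i≡δ+k))
  ...   | inj₂ refl = inj₂ (inj₂ (inj₂ i≡δ+k))

  C-neighbours : ∀ i {w} → C i ~ w → w ≡ C (suc i) ⊎ w ≡ C (i + q′) ⊎ w ≡ X i
  C-neighbours i {w} cw with neighbours-⊆ G regular (C i) unique (C-adjacent i ∷ C-adjacent-pred i ∷ C~X i ∷ [])
                                         refl w cw
    where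
    C-suc≢C-pred : C (suc i) ≢ C (i + q′)
    C-suc≢C-pred e =
      contradiction (offset-injective 2 0 (≡-mod-trans (≡-mod-+ˡ 1 (C-injective e)) (suc-pred-mod i))) λ ()
    unique : Unique (C (suc i) ∷ C (i + q′) ∷ X i ∷ [])
    unique = (C-suc≢C-pred ∷ X≢C i (suc i) ∘ sym ∷ []) ∷ (X≢C i (i + q′) ∘ sym ∷ []) ∷ [] ∷ []
  ... | here w≡                 = inj₁ w≡
  ... | there (here w≡)         = inj₂ (inj₁ w≡)
  ... | there (there (here w≡)) = inj₂ (inj₂ w≡)

  C-or-X : ∀ v → ∃ λ i → v ≡ C i ⊎ v ≡ X i
  C-or-X v with injective⇒surjective q+q≡n (embed ∘ splitAt q) (splitAt-injective ∘ embed-injective) v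
    where
    q+q≡n : q + q ≡ n
    q+q≡n = trans (cong (q +_) (sym (+-identityʳ q))) (sym n≡2q)
    embed : Fin q ⊎ Fin q → Fin n
    embed = Sum.[ c , X ∘ toℕ ]
    embed-injective : ∀ {u v} → embed u ≡ embed v → u ≡ v
    embed-injective {inj₁ a} {inj₁ b} e = cong inj₁ (proj₁ (proj₂ (proj₁ isometric)) a b e)
    embed-injective {inj₁ a} {inj₂ b} e =
      ⊥-elim (X≢C (toℕ b) (toℕ a) (trans (sym e) (cong c (sym (mod-toℕ a)))))
    embed-injective {inj₂ a} {inj₁ b} e =
      ⊥-elim (X≢C (toℕ a) (toℕ b) (trans e (cong c (sym (mod-toℕ b)))))
    embed-injective {inj₂ a} {inj₂ b} e =
      cong inj₂ (toℕ-injective (≡-mod⇒≡ (toℕ<n a) (toℕ<n b) (X-injective e)))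
    splitAt-injective : ∀ {x y} → splitAt q x ≡ splitAt q y → x ≡ y
    splitAt-injective {x} {y} e = trans (sym (join-splitAt q q x)) (trans (cong (join q q) e) (join-splitAt q q y))
  ... | k , e with splitAt q k
  ...   | inj₁ a = toℕ a , inj₁ (trans (sym e) (cong c (sym (mod-toℕ a))))
  ...   | inj₂ b = toℕ b , inj₂ (sym e)

  -- The centre is X (3 + i) rather than X i so that its four possible chord partners X (3 + i ± 2),
  -- X (3 + i ± 3) have indices without subtraction.
  chordCandidate : ℕ → Fin 4 → Fin n
  chordCandidate i = Vec.lookup (X (5 + i) ∷ X (6 + i) ∷ X (1 + i) ∷ X i ∷ [])

  X-neighbours : ∀ i {w} → X (3 + i) ~ w → w ≢ C (3 + i) → ∃ λ t → w ≡ chordCandidate i t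
  X-neighbours i {w} xw w≢C with C-or-X w
  ... | k , inj₁ refl with C-neighbours k (adjacent-sym G xw)
  ...   | inj₁ e        = ⊥-elim (X≢C (3 + i) (suc k) e)
  ...   | inj₂ (inj₁ e) = ⊥-elim (X≢C (3 + i) (k + q′) e)
  ...   | inj₂ (inj₂ e) = ⊥-elim (w≢C (C-cong (≡-mod-sym (X-injective e))))
  X-neighbours i xw w≢C | k , inj₂ refl with X~X xw
  ...   | inj₁ e               = 0F , X-cong e
  ...   | inj₂ (inj₁ e)        = 1F , X-cong e
  ...   | inj₂ (inj₂ (inj₁ e)) = 2F , X-cong (≡-mod-sym (≡-mod-cancel-+ˡ 2 e))
  ...   | inj₂ (inj₂ (inj₂ e)) = 3F , X-cong (≡-mod-sym (≡-mod-cancel-+ˡ 3 e))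

  chord₂ chord₃ : ℕ → Bool
  chord₂ i = adj G (X i) (X (2 + i))
  chord₃ i = adj G (X i) (X (3 + i))

  chordFlags : ℕ → Fin 4 → Bool
  chordFlags i = Vec.lookup (chord₂ (3 + i) ∷ chord₃ (3 + i) ∷ chord₂ (1 + i) ∷ chord₃ i ∷ [])

  chordFlags≡adj : ∀ i t → chordFlags i t ≡ adj G (X (3 + i)) (chordCandidate i t)
  chordFlags≡adj i 0F = refl
  chordFlags≡adj i 1F = refl
  chordFlags≡adj i 2F = Graph.sym G _ _
  chordFlags≡adj i 3F = Graph.sym G _ _

  two-chords : ∀ i → 2 ≤ trues (chordFlags i)
  two-chords i
    with w₁ , xw₁ , w₁∉ ← neighbour-∉ G regular (X (3 + i)) (C (3 + i) ∷ []) (from-yes (1 <? 3))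
    with w₂ , xw₂ , w₂∉ ← neighbour-∉ G regular (X (3 + i)) (C (3 + i) ∷ w₁ ∷ []) (from-yes (2 <? 3))
    with t₁ , refl ← X-neighbours i xw₁ (w₁∉ ∘ here)
    with t₂ , refl ← X-neighbours i xw₂ (w₂∉ ∘ here)
    = length-≤-trues (chordFlags i) ((t₁≢t₂ ∷ []) ∷ [] ∷ []) (flag t₁ xw₁ ∷ flag t₂ xw₂ ∷ [])
    where
    t₁≢t₂ : t₁ ≢ t₂
    t₁≢t₂ refl = w₂∉ (there (here refl))
    flag : ∀ t → X (3 + i) ~ chordCandidate i t → chordFlags i t ≡ true
    flag t = trans (chordFlags≡adj i t)

  shortcut : ∀ {i a m} → a + a ≤ q → Walk G (C i) (C (a + i)) m → ¬ m < a
  shortcut 2a≤q w = ≤⇒≯ (C-isometric 2a≤q w)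

  10≤q : 10 ≤ q
  10≤q = ≤-trans (from-yes (10 ≤? 12)) 12≤q

  no-chord₃-chord₃ : ∀ i → chord₃ i ≡ true → chord₃ (3 + i) ≡ true → ⊥
  no-chord₃-chord₃ i x₀x₃ x₃x₆ =
    shortcut 12≤q (step (C~X i) (step x₀x₃ (step x₃x₆ (step (X~C (6 + i)) here)))) (from-yes (4 <? 6))

  no-chord₂-chord₃ : ∀ i → chord₂ i ≡ true → chord₃ (2 + i) ≡ true → ⊥
  no-chord₂-chord₃ i x₀x₂ x₂x₅ =
    shortcut 10≤q (step (C~X i) (step x₀x₂ (step x₂x₅ (step (X~C (5 + i)) here)))) (from-yes (4 <? 5))

  no-chord₃-chord₂ : ∀ i → chord₃ i ≡ true → chord₂ (3 + i) ≡ true → ⊥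
  no-chord₃-chord₂ i x₀x₃ x₃x₅ =
    shortcut 10≤q (step (C~X i) (step x₀x₃ (step x₃x₅ (step (X~C (5 + i)) here)))) (from-yes (4 <? 5))

  no-chord₂-chord₂-chord₂ : ∀ i → chord₂ i ≡ true → chord₂ (2 + i) ≡ true → chord₂ (4 + i) ≡ true → ⊥
  no-chord₂-chord₂-chord₂ i x₀x₂ x₂x₄ x₄x₆ =
    shortcut 12≤q (step (C~X i) (step x₀x₂ (step x₂x₄ (step x₄x₆ (step (X~C (6 + i)) here)))))
             (from-yes (5 <? 6))

  chord₃-periodic : ∀ i → chord₃ (q + i) ≡ chord₃ i
  chord₃-periodic i = cong₂ (adj G) (X-cong q+i≡i) (X-cong (≡-mod-+ˡ 3 q+i≡i))
    where
    q+i≡i : q + i ≡ i [mod q ]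
    q+i≡i = ≡-mod-trans (≡⇒≡-mod (+-comm q i)) (≡-mod-+d i)

  open ChordSequences chord₂ chord₃ two-chords no-chord₃-chord₃ no-chord₂-chord₃ no-chord₃-chord₂
                      no-chord₂-chord₂-chord₂ q′ chord₃-periodic
    public using (phase; 5∣period)

  module Embedding {j′ : ℕ} (q≡j*5 : q ≡ suc j′ * 5) (r : ℕ)
    (phase : ∀ m → chord₂ (m + r) ≡ chordPattern₂ m × chord₃ (m + r) ≡ chordPattern₃ m) where

    vertexAt : Layer → ℕ → Fin n
    vertexAt outer m = C (m + r)
    vertexAt inner m = X (m + r)

    vertexAt-injective : ∀ {ℓ ℓ′ m m′} → m < q → m′ < q →
                         vertexAt ℓ m ≡ vertexAt ℓ′ m′ → ℓ ≡ ℓ′ × m ≡ m′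
    vertexAt-injective {outer} {outer} {m} {m′} m<q m′<q e =
      refl , ≡-mod⇒≡ m<q m′<q (≡-mod-cancel-+ʳ r (C-injective {m + r} {m′ + r} e))
    vertexAt-injective {inner} {inner} {m} {m′} m<q m′<q e =
      refl , ≡-mod⇒≡ m<q m′<q (≡-mod-cancel-+ʳ r (X-injective {m + r} {m′ + r} e))
    vertexAt-injective {outer} {inner} {m} {m′} _ _ e = ⊥-elim (X≢C (m′ + r) (m + r) (sym e))
    vertexAt-injective {inner} {outer} {m} {m′} _ _ e = ⊥-elim (X≢C (m + r) (m′ + r) e)

    chord₂-in-block : ∀ s o → T (chordPattern₂ s) → X (s + o * 5 + r) ~ X (2 + s + o * 5 + r)
    chord₂-in-block s o p = trans (proj₁ (phase (s + o * 5))) (trans (chordPattern₂-shift s o) (T-≡ .to p))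

    chord₃-in-block : ∀ s o → T (chordPattern₃ s) → X (s + o * 5 + r) ~ X (3 + s + o * 5 + r)
    chord₃-in-block s o p = trans (proj₂ (phase (s + o * 5))) (trans (chordPattern₃-shift s o) (T-≡ .to p))

    blockAdj-sound : ∀ ℓ s ℓ′ s′ o → T (blockAdj ℓ s ℓ′ s′) →
                     vertexAt ℓ (s + o * 5) ~ vertexAt ℓ′ (s′ + o * 5)
    blockAdj-sound outer s outer s′ o e with T-∨ .to e
    ... | inj₁ s′≡1+s rewrite ≡ᵇ⇒≡ s′ (suc s) s′≡1+s = C-adjacent (s + o * 5 + r)
    ... | inj₂ s≡1+s′ rewrite ≡ᵇ⇒≡ s (suc s′) s≡1+s′ = adjacent-sym G (C-adjacent (s′ + o * 5 + r))
    blockAdj-sound outer s inner s′ o e rewrite ≡ᵇ⇒≡ s s′ e = C~X (s′ + o * 5 + r)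
    blockAdj-sound inner s outer s′ o e rewrite ≡ᵇ⇒≡ s s′ e = X~C (s′ + o * 5 + r)
    blockAdj-sound inner s inner s′ o e with T-∨ .to e
    ... | inj₁ e₂ with s′≡2+s , p ← T-∧ .to e₂ rewrite ≡ᵇ⇒≡ s′ (2 + s) s′≡2+s = chord₂-in-block s o p
    ... | inj₂ e′ with T-∨ .to e′
    ...   | inj₁ e₃ with s′≡3+s , p ← T-∧ .to e₃ rewrite ≡ᵇ⇒≡ s′ (3 + s) s′≡3+s = chord₃-in-block s o p
    ...   | inj₂ e″ with T-∨ .to e″
    ...     | inj₁ e₂ with s≡2+s′ , p ← T-∧ .to e₂ rewrite ≡ᵇ⇒≡ s (2 + s′) s≡2+s′ =
      adjacent-sym G (chord₂-in-block s′ o p)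
    ...     | inj₂ e₃ with s≡3+s′ , p ← T-∧ .to e₃ rewrite ≡ᵇ⇒≡ s (3 + s′) s≡3+s′ =
      adjacent-sym G (chord₃-in-block s′ o p)

    succMod⇒≡-mod : ∀ i i′ → T (succMod (suc j′) i i′) → suc (toℕ i) * 5 ≡ toℕ i′ * 5 [mod q ]
    succMod⇒≡-mod i i′ e with T-∨ .to e
    ... | inj₁ next = ≡⇒≡-mod (cong (_* 5) (≡ᵇ⇒≡ (suc (toℕ i)) (toℕ i′) next))
    ... | inj₂ wrap with last , first ← T-∧ .to wrap =
      ≡-mod-trans (≡⇒≡-mod (trans (cong (_* 5) (≡ᵇ⇒≡ (suc (toℕ i)) (suc j′) last)) (sym q≡j*5)))
                  (≡-mod-trans (≡-mod-+d 0) (≡⇒≡-mod (cong (_* 5) (sym (≡ᵇ⇒≡ (toℕ i′) 0 first)))))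

    φ : Fin (suc j′) × Fin 10 → Fin n
    φ (i , a) = vertexAt (layer a) (position a + toℕ i * 5)

    cross-edge : ∀ i i′ → T (succMod (suc j′) i i′) → φ (i , 1F) ~ φ (i′ , 0F)
    cross-edge i i′ e = subst (C (4 + toℕ i * 5 + r) ~_) (C-cong (≡-mod-+ʳ r (succMod⇒≡-mod i i′ e)))
                              (C-adjacent (4 + toℕ i * 5 + r))

    φ-preserves : ∀ {p p′} → FAdj (suc j′) p p′ ≡ true → φ p ~ φ p′
    φ-preserves {i , a} {i′ , a′} e with T-∨ .to (T-≡ .from e)
    ... | inj₁ same with T-∧ .to same
    ...   | i≡i′ , pet rewrite toℕ-injective {i = i} {i′} (≡ᵇ⇒≡ (toℕ i) (toℕ i′) i≡i′) =
      blockAdj-sound (layer a) (position a) (layer a′) (position a′) (toℕ i′) (petersen-block a a′ pet)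
    φ-preserves {i , a} {i′ , a′} e | inj₂ cross with T-∨ .to cross
    ... | inj₁ forward with T-∧ .to forward
    ...   | a≡v , rest with T-∧ .to rest
    ...     | a′≡u , next with refl ← toℕ-injective {i = a} {1F} (≡ᵇ⇒≡ (toℕ a) 1 a≡v)
                          | refl ← toℕ-injective {i = a′} {0F} (≡ᵇ⇒≡ (toℕ a′) 0 a′≡u) = cross-edge i i′ next
    φ-preserves {i , a} {i′ , a′} e | inj₂ cross | inj₂ backward with T-∧ .to backward
    ...   | a≡u , rest with T-∧ .to rest
    ...     | a′≡v , next with refl ← toℕ-injective {i = a} {0F} (≡ᵇ⇒≡ (toℕ a) 0 a≡u)
                          | refl ← toℕ-injective {i = a′} {1F} (≡ᵇ⇒≡ (toℕ a′) 1 a′≡v) =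
      adjacent-sym G (cross-edge i′ i next)

    position-combine : ∀ (i : Fin (suc j′)) a → position a + toℕ i * 5 ≡ toℕ (combine i (proj₂ (label a)))
    position-combine i a = begin
      position a + toℕ i * 5              ≡⟨ +-comm (position a) (toℕ i * 5) ⟩
      toℕ i * 5 + position a              ≡⟨ cong (_+ position a) (*-comm (toℕ i) 5) ⟩
      5 * toℕ i + position a              ≡⟨ toℕ-combine i (proj₂ (label a)) ⟨
      toℕ (combine i (proj₂ (label a)))   ∎
      where open ≡-Reasoning

    position<q : ∀ (i : Fin (suc j′)) a → position a + toℕ i * 5 < q
    position<q i a =
      subst₂ _<_ (sym (position-combine i a)) (sym q≡j*5) (toℕ<n (combine i (proj₂ (label a))))

    φ-injective : ∀ {p p′} → φ p ≡ φ p′ → p ≡ p′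
    φ-injective {i , a} {i′ , a′} e
      with layer≡ , position≡ ← vertexAt-injective (position<q i a) (position<q i′ a′) e =
      cong₂ _,_ (combine-injectiveˡ i s i′ s′ combine≡)
                (label-injective a a′ (cong₂ _,_ layer≡ (combine-injectiveʳ i s i′ s′ combine≡)))
      where
      s s′ : Fin 5
      s  = proj₂ (label a)
      s′ = proj₂ (label a′)
      combine≡ : combine i s ≡ combine i′ s′
      combine≡ = toℕ-injective (trans (sym (position-combine i a)) (trans position≡ (position-combine i′ a′)))

    cardinality : suc j′ * 10 ≡ n
    cardinality = begin
      suc j′ * (5 * 2)    ≡⟨ *-assoc (suc j′) 5 2 ⟨
      suc j′ * 5 * 2      ≡⟨ *-comm (suc j′ * 5) 2 ⟩
      2 * (suc j′ * 5)    ≡⟨ cong (2 *_) q≡j*5 ⟨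
      2 * q               ≡⟨ n≡2q ⟨
      n                   ∎
      where open ≡-Reasoning

    isomorphic : Isomorphic G (FAdj (suc j′))
    isomorphic = embedding⇒isomorphic {G = G} φ φ-injective′ (*↔× {suc j′} {10}) cardinality
      (φ-reflects G regular (FAdj (suc j′)) φ φ-injective′ (λ {p} {p′} → φ-preserves {p} {p′})
                  FNeighbours FNeighbours-length FNeighbours-unique FNeighbours-adjacent)
      where
      φ-injective′ : ∀ {p p′} → φ p ≡ φ p′ → p ≡ p′
      φ-injective′ {p} {p′} = φ-injective {p} {p′}

theorem31 : ∀ {n : ℕ} (G : Graph n) (q : ℕ)
    → Regular G 3
    → Girth G 5
    → Equator G q
    → 15 < q
    → n ≡ 2 * q
    → Σ ℕ (λ j → (q ≡ 5 * j) × (3 ≤ j) × Isomorphic G (FAdj j))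
theorem31 G (suc q′) regular (_ , girth≥5) ((c , isometric) , _) 15<q n≡2q = conclude 5∣period
  where
  open Equatorial regular girth≥5 c isometric (≤-trans (from-yes (12 ≤? 16)) 15<q) n≡2q
  conclude : 5 ∣ suc q′ → Σ ℕ (λ j → (suc q′ ≡ 5 * j) × (3 ≤ j) × Isomorphic G (FAdj j))
  conclude (divides (suc j′) q≡j*5) =
    suc j′ , trans q≡j*5 (*-comm (suc j′) 5) ,
    *-cancelʳ-< 5 2 (suc j′) (≤-trans (from-yes (11 ≤? 16)) (subst (16 ≤_) q≡j*5 15<q)) ,
    Embedding.isomorphic q≡j*5 (proj₁ phase) (proj₂ phase)
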